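{- Let $m\ge 4$ be an integer with $m\equiv 1\pmod 3$, and let $1\le r<m$. Then $sp(m^2j+m+r,m)\equiv 0\pmod 3$ for all $j\ge 0$.
   Context: For fixed $m>1$, $sp(n,m)$ is defined by: $sp(n,m)=0$ for $n<0$, $sp(0,m)=1$, $sp(n,m)=1$ for $1\le n\le m-1$, and for $n\ge m$: $sp(n,m)=sp(n/m,m)$ if $m\mid n$, and $sp(n,m)=2sp(n-r,m)+sp(n-m,m)$ if $n\equiv r\pmod m$ with $0<r<m$. (It counts semi-$m$-Pell compositions of $n$.) -}

module Defs where

open import Data.Nat using (ℕ; zero; suc; _+_; _*_; _∸_; _<ᵇ_; _≡ᵇ_)
open import Data.Nat.DivMod using (_/_; _%_)
open import Data.Bool using (Bool; true; false; if_then_else_)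

-- Semi-m-Pell composition count sp(n,m), for m > 1.
-- Arguments are natural numbers, so the clause sp(n,m)=0 for n<0 is
-- realised by guarding the subtraction n-m (when n-m would be negative,
-- which cannot happen for n ≥ m, but we keep the convention explicit).
--
-- Recursion on n is not structural (n/m, n-r, n-m), so we use fuel:
-- spF f n m with f > n is enough, since every recursive call strictly
-- decreases n (for m ≥ 2: n/m < n when n ≥ m ≥ 2; n - r < n; n - m < n).
-- For m = 0 or 1 the value is irrelevant (the paper requires m > 1).
spF : ℕ → ℕ → ℕ → ℕ
spF zero    n m = 0
spF (suc f) zero m = 1
spF (suc f) (suc k) zero = 0
spF (suc f) (suc k) (suc zero) = 0
spF (suc f) n (suc (suc k')) with n <ᵇ suc (suc k')
... | true  = 1
... | false with n % suc (suc k')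
...   | zero  = spF f (n / suc (suc k')) (suc (suc k'))
...   | suc r' = 2 * spF f (n ∸ suc r') (suc (suc k'))
               + spF f (n ∸ suc (suc k')) (suc (suc k'))

sp : ℕ → ℕ → ℕ
sp n m = spF (suc n) n m

module Submission where

-- For 0 < r < m the recurrence gives sp(qm + r) = 2 sp(qm) + sp((q-1)m + r) = 2 sp(q) + sp((q-1)m + r),
-- so by induction on q it equals 1 + 2 S(q) with S(q) = sp(1) + ... + sp(q), independently of r.
-- Summing block by block, each block [qm+1, (q+1)m] contributes m - 1 copies of 1 + 2 S(q) plus
-- sp((q+1)m) = sp(q+1); hence S(jm) = (m - 1) T(j) + S(j) with T(j) = Σ_{q<j} (1 + 2 S(q)). Then
-- sp(m²j + m + r) = 1 + 2 S(jm + 1) = 1 + 2 (S(jm) + 1 + 2 S(j)) = 3 + 2 (m - 1) T(j) + 6 S(j),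
-- which is divisible by 3 as soon as 3 ∣ m - 1.

open import Defs
open import Data.Bool using (true; false)
open import Data.Bool.Properties using (T-≡; ¬-not)
open import Data.Nat
open import Data.Nat.DivMod
open import Data.Nat.Divisibility
open import Data.Nat.Properties
open import Data.Nat.Tactic.RingSolver using (solve-∀)
open import Function.Bundles using (Equivalence)
open import Relation.Binary.PropositionalEquality

<ᵇ-true : ∀ {a b} → a < b → (a <ᵇ b) ≡ true
<ᵇ-true a<b = Equivalence.to T-≡ (<⇒<ᵇ a<b)

<ᵇ-false : ∀ {a b} → b ≤ a → (a <ᵇ b) ≡ false
<ᵇ-false {a} {b} b≤a = ¬-not λ a<ᵇb → ≤⇒≯ b≤a (<ᵇ⇒< a b (Equivalence.from T-≡ a<ᵇb))

module SemiPell (k : ℕ) where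

  m : ℕ
  m = 2 + k

  1<m : 1 < m
  1<m = s≤s (s≤s z≤n)

  spF-step-cong : ∀ f g n → (∀ x → x ≤ n → spF f x m ≡ spF g x m) →
    spF (suc f) (suc n) m ≡ spF (suc g) (suc n) m
  spF-step-cong f g n below with suc n <ᵇ m
  ... | true = refl
  ... | false with suc n % m
  ...   | zero  = below (suc n / m) (<⇒≤pred (m/n<m (suc n) m 1<m))
  ...   | suc r = cong₂ (λ a b → 2 * a + b) (below (n ∸ r) (m∸n≤m n r)) (below (n ∸ suc k) (m∸n≤m n (suc k)))

  spF-fuel : ∀ f g n → n < f → n < g → spF f n m ≡ spF g n m
  spF-fuel (suc f) (suc g) zero    _         _         = refl
  spF-fuel (suc f) (suc g) (suc n) (s≤s n<f) (s≤s n<g) =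
    spF-step-cong f g n λ x x≤n → spF-fuel f g x (≤-<-trans x≤n n<f) (≤-<-trans x≤n n<g)

  spF≡sp : ∀ f n → n < f → spF f n m ≡ sp n m
  spF≡sp f n n<f = spF-fuel f (suc n) n n<f ≤-refl

  sp-small : ∀ {n} → 0 < n → n < m → sp n m ≡ 1
  sp-small {suc n} _ n<m rewrite <ᵇ-true n<m = refl

  sp-multiple : ∀ q → sp (suc q * m) m ≡ sp (suc q) m
  sp-multiple q rewrite <ᵇ-false (m≤m+n m (q * m)) | m*n%n≡0 (suc q) m ⦃ _ ⦄ =
    trans (cong (λ x → spF (suc q * m) x m) (m*n/n≡m (suc q) m))
          (spF≡sp (suc q * m) (suc q) (m<m*n (suc q) m 1<m))

  sp-nonmultiple : ∀ {n r} → m ≤ n → n % m ≡ suc r →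
    sp n m ≡ 2 * sp (n ∸ suc r) m + sp (n ∸ m) m
  sp-nonmultiple {suc n} {r} m≤n n%m≡1+r rewrite <ᵇ-false m≤n | n%m≡1+r =
    cong₂ (λ a b → 2 * a + b)
      (spF≡sp (suc n) (n ∸ r) (s≤s (m∸n≤m n r)))
      (spF≡sp (suc n) (n ∸ suc k) (s≤s (m∸n≤m n (suc k))))

  spSum : ℕ → ℕ
  spSum zero    = 0
  spSum (suc q) = spSum q + sp (suc q) m

  sp-residue : ∀ q r → suc r < m → sp (suc r + q * m) m ≡ 1 + 2 * spSum q
  sp-residue zero    r r<m = trans (cong (λ x → sp x m) (+-identityʳ (suc r))) (sp-small z<s r<m)
  sp-residue (suc q) r r<m = begin
    sp n m                                          ≡⟨ sp-nonmultiple m≤n n%m≡1+r ⟩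
    2 * sp (n ∸ suc r) m + sp (n ∸ m) m             ≡⟨ cong₂ (λ a b → 2 * sp a m + sp b m) (m+n∸m≡n (suc r) (suc q * m)) n∸m≡r+qm ⟩
    2 * sp (suc q * m) m + sp (suc r + q * m) m     ≡⟨ cong₂ (λ a b → 2 * a + b) (sp-multiple q) (sp-residue q r r<m) ⟩
    2 * sp (suc q) m + (1 + 2 * spSum q)            ≡⟨ double-step (sp (suc q) m) (spSum q) ⟩
    1 + 2 * spSum (suc q)                           ∎
    where
      open ≡-Reasoning
      n : ℕ
      n = suc r + suc q * m
      m≤n : m ≤ n
      m≤n = ≤-trans (m≤m+n m (q * m)) (m≤n+m (suc q * m) (suc r))
      n%m≡1+r : n % m ≡ suc r
      n%m≡1+r = trans ([m+kn]%n≡m%n (suc r) (suc q) m) (m<n⇒m%n≡m r<m)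
      shift : ∀ a b c → suc a + suc b * c ≡ c + (suc a + b * c)
      shift = solve-∀
      n∸m≡r+qm : n ∸ m ≡ suc r + q * m
      n∸m≡r+qm = trans (cong (_∸ m) (shift r q m)) (m+n∸m≡n m (suc r + q * m))
      double-step : ∀ a s → 2 * a + (1 + 2 * s) ≡ 1 + 2 * (s + a)
      double-step = solve-∀

  spSum-within-block : ∀ j s → s < m → spSum (j * m + s) ≡ spSum (j * m) + s * (1 + 2 * spSum j)
  spSum-within-block j zero    _   = trans (cong spSum (+-identityʳ (j * m))) (sym (+-identityʳ _))
  spSum-within-block j (suc s) s<m = begin
    spSum (j * m + suc s)                                       ≡⟨ cong spSum (+-suc (j * m) s) ⟩
    spSum (j * m + s) + sp (suc (j * m + s)) m                  ≡⟨ cong₂ _+_ (spSum-within-block j s (<-trans (n<1+n s) s<m)) sp-next ⟩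
    spSum (j * m) + s * (1 + 2 * spSum j) + (1 + 2 * spSum j)   ≡⟨ +-assoc (spSum (j * m)) _ _ ⟩
    spSum (j * m) + (s * (1 + 2 * spSum j) + (1 + 2 * spSum j)) ≡⟨ cong (spSum (j * m) +_) (+-comm (s * _) _) ⟩
    spSum (j * m) + suc s * (1 + 2 * spSum j)                   ∎
    where
      open ≡-Reasoning
      sp-next : sp (suc (j * m + s)) m ≡ 1 + 2 * spSum j
      sp-next = trans (cong (λ x → sp (suc x) m) (+-comm (j * m) s)) (sp-residue j s s<m)

  residueSum : ℕ → ℕ
  residueSum zero    = 0
  residueSum (suc q) = residueSum q + (1 + 2 * spSum q)

  spSum-multiple : ∀ j → spSum (j * m) ≡ suc k * residueSum j + spSum j
  spSum-multiple zero    = sym (cong (_+ 0) (*-zeroʳ (suc k)))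
  spSum-multiple (suc j) = begin
    spSum (suc j * m)                                                          ≡⟨ cong spSum (block-end j k) ⟩
    spSum (j * m + suc k) + sp (suc (j * m + suc k)) m                         ≡⟨ cong₂ _+_ (spSum-within-block j (suc k) ≤-refl) sp-block-end ⟩
    spSum (j * m) + suc k * (1 + 2 * spSum j) + sp (suc j) m                   ≡⟨ cong (λ x → x + suc k * (1 + 2 * spSum j) + sp (suc j) m) (spSum-multiple j) ⟩
    suc k * residueSum j + spSum j + suc k * (1 + 2 * spSum j) + sp (suc j) m ≡⟨ regroup (suc k) (residueSum j) (spSum j) (1 + 2 * spSum j) (sp (suc j) m) ⟩
    suc k * residueSum (suc j) + spSum (suc j)                                 ∎
    where
      open ≡-Reasoning
      block-end : ∀ j k → suc j * (2 + k) ≡ suc (j * (2 + k) + suc k)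
      block-end = solve-∀
      sp-block-end : sp (suc (j * m + suc k)) m ≡ sp (suc j) m
      sp-block-end = trans (cong (λ x → sp x m) (sym (block-end j k))) (sp-multiple j)
      regroup : ∀ c t s u p → c * t + s + c * u + p ≡ c * (t + u) + (s + p)
      regroup = solve-∀

  sp-formula : ∀ j r → suc r < m →
    sp (m ^ 2 * j + m + suc r) m ≡ 3 + 2 * (suc k * residueSum j) + 6 * spSum j
  sp-formula j r r<m = begin
    sp (m ^ 2 * j + m + suc r) m                                  ≡⟨ cong (λ x → sp x m) (reindex m j r) ⟩
    sp (suc r + suc (j * m) * m) m                                ≡⟨ sp-residue (suc (j * m)) r r<m ⟩
    1 + 2 * (spSum (j * m) + sp (suc (j * m)) m)                  ≡⟨ cong₂ (λ a b → 1 + 2 * (a + b)) (spSum-multiple j) (sp-residue j 0 1<m) ⟩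
    1 + 2 * (suc k * residueSum j + spSum j + (1 + 2 * spSum j))  ≡⟨ collect (suc k * residueSum j) (spSum j) ⟩
    3 + 2 * (suc k * residueSum j) + 6 * spSum j                  ∎
    where
      open ≡-Reasoning
      -- m ^ 2 unfolds to m * (m * 1), the form the solver is given.
      reindex : ∀ n j r → n * (n * 1) * j + n + suc r ≡ suc r + suc (j * n) * n
      reindex = solve-∀
      collect : ∀ t s → 1 + 2 * (t + s + (1 + 2 * s)) ≡ 3 + 2 * t + 6 * s
      collect = solve-∀

theorem4p3 : (m r : ℕ) → 4 ≤ m → m % 3 ≡ 1 → 1 ≤ r → r < m →
    (j : ℕ) → 3 ∣ sp (m ^ 2 * j + m + r) m
theorem4p3 m@(suc (suc k)) (suc r) (s≤s (s≤s _)) m%3≡1 _ r<m j =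
  subst (3 ∣_) (sym (sp-formula j r r<m))
    (∣m∣n⇒∣m+n (∣m∣n⇒∣m+n ∣-refl (∣n⇒∣m*n 2 (∣m⇒∣m*n (residueSum j) 3∣m-1)))
               (∣m⇒∣m*n (spSum j) (divides 2 refl)))
  where
    open SemiPell k using (sp-formula; residueSum; spSum)
    3∣m-1 : 3 ∣ suc k
    3∣m-1 = divides (m / 3) (suc-injective (trans (m≡m%n+[m/n]*n m 3) (cong (_+ m / 3 * 3) m%3≡1)))
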